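{- Let $r,s,t,m$ be positive integers and let $G$ be a graph with no copy of $K_r$ as a subgraph and no copy of $K_{s,t}$ as an induced subgraph. If $\{x_1,\dots, x_{m-1}\}$ is a clique of order $m-1$ in $G$ and $d(x_1,\dots, x_{m-1}) > R(r-m+1, s)$, then the number of independent sets of order $s$ in $\Gamma(x_1,\dots, x_{m-1})$ is at least \[ \left(\frac{d(x_1,\dots, x_{m-1})}{2(r+s)^s}\right)^s. \]
   Context: $N(x_1,\dots,x_k)$ is the set of vertices adjacent to every vertex of $\{x_1,\dots,x_k\}$, $d(x_1,\dots,x_k)=|N(x_1,\dots,x_k)|$, and $\Gamma(x_1,\dots,x_k)$ is the subgraph of $G$ induced by $N(x_1,\dots,x_k)$. The Ramsey number $R(a,b)$ is the smallest $N$ such that every red/blue coloring of the edges of $K_N$ contains a red $K_a$ or a blue $K_b$ (equivalently, every graph on $N$ vertices contains a clique of order $a$ or an independent set of order $b$). -}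

module Defs where

open import Data.Bool using (Bool; true; false; _∧_; _∨_; not)
open import Data.Nat using (ℕ; zero; suc; _≤_)
open import Data.Fin using (Fin)
open import Data.Fin.Properties using (_≟_)
open import Data.Fin.Subset using (Subset; ∣_∣)
open import Data.Vec using (Vec; []; _∷_; lookup; tabulate)
open import Data.List using (List; [_]; _++_; map; allFin; filterᵇ; length)
open import Data.Bool.ListAction using (all)
open import Data.Product using (Σ; _×_; ∃; ∃-syntax)
open import Data.Sum using (_⊎_)
open import Relation.Nullary using (¬_)
open import Relation.Nullary.Decidable using (⌊_⌋)
open import Relation.Binary.PropositionalEquality using (_≡_)

record Graph (n : ℕ) : Set where
  field
    adj    : Fin n → Fin n → Bool
    sym    : ∀ i j → adj i j ≡ adj j i
    irrefl : ∀ i → adj i i ≡ false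
open Graph public

module _ {n : ℕ} (G : Graph n) where

  mem : Fin n → Subset n → Bool
  mem i S = lookup S i

  isClique : Subset n → Bool
  isClique S = all (λ i → all (λ j →
      not (mem i S ∧ mem j S) ∨ ⌊ i ≟ j ⌋ ∨ adj G i j) (allFin n)) (allFin n)

  isIndep : Subset n → Bool
  isIndep S = all (λ i → all (λ j →
      not (mem i S ∧ mem j S) ∨ not (adj G i j)) (allFin n)) (allFin n)

  subsetOf : Subset n → Subset n → Bool
  subsetOf S T = all (λ i → not (mem i S) ∨ mem i T) (allFin n)

  disjoint : Subset n → Subset n → Bool
  disjoint S T = all (λ i → not (mem i S ∧ mem i T)) (allFin n)

  HasClique : ℕ → Set
  HasClique k = ∃[ S ] (∣ S ∣ ≡ k × isClique S ≡ true)

  HasIndep : ℕ → Set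
  HasIndep k = ∃[ S ] (∣ S ∣ ≡ k × isIndep S ≡ true)

  HasInducedKst : ℕ → ℕ → Set
  HasInducedKst s t = ∃[ A ] ∃[ B ]
    ( ∣ A ∣ ≡ s × ∣ B ∣ ≡ t × disjoint A B ≡ true
    × isIndep A ≡ true × isIndep B ≡ true
    × (∀ a b → mem a A ≡ true → mem b B ≡ true → adj G a b ≡ true))

  commonNbhd : Subset n → Subset n
  commonNbhd X = tabulate (λ v → all (λ x → not (mem x X) ∨ adj G x v) (allFin n))

  deg : Subset n → ℕ
  deg X = ∣ commonNbhd X ∣

allSubsets : (n : ℕ) → List (Subset n)
allSubsets zero    = [ [] ]
allSubsets (suc n) = map (true ∷_) (allSubsets n) ++ map (false ∷_) (allSubsets n)

-- number of independent sets of order s in Γ(X), the subgraph induced by N(X)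
-- (a subset of N(X) is independent in Γ(X) iff it is independent in G)
numIndepInNbhd : {n : ℕ} → Graph n → Subset n → ℕ → ℕ
numIndepInNbhd {n} G X s = length (filterᵇ
  (λ S → subsetOf G S (commonNbhd G X) ∧ isIndep G S ∧ ⌊ ∣ S ∣ Data.Nat.≟ s ⌋)
  (allSubsets n))

RamseyProp : ℕ → ℕ → ℕ → Set
RamseyProp a b N = (H : Graph N) → HasClique H a ⊎ HasIndep H b

IsRamseyNumber : ℕ → ℕ → ℕ → Set
IsRamseyNumber a b N = RamseyProp a b N × (∀ M → RamseyProp a b M → N ≤ M)

-- Let U = N(x₁, …, x_{m−1}) and a = r − m + 1. A clique of order a in U together with the
-- clique {x₁, …, x_{m−1}} would give a K_r, so U is K_a-free. Write I(U, s) for the number of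
-- independent s-sets in U. If a^s·k ≤ |U| then k^s·a^(s(s−1)/2) ≤ s!·I(U, s), by induction on s.
-- When a^(s+1)·k ≤ |U|, at most (a − 1)·a^s·k vertices of U have fewer than a^s·k
-- non-neighbours in U (otherwise a greedy choice among them builds a K_a), so at least a^s·k
-- vertices v have that many; the induction hypothesis applies to the non-neighbourhood of each
-- such v, every independent s-set there extends by v, and each independent (s+1)-set arises
-- from at most s + 1 vertices v. When |U| ≥ a^s, taking k = ⌊|U| / a^s⌋ and using
-- a^(s(s+1)/2)·s! ≤ (r+s)^(s²) gives the bound. When |U| < a^s one independent s-set suffices,
-- and |U| > R(a, s) provides it.
module Submission where

open import Data.Bool using (Bool; true; false; _∧_; _∨_; not)
open import Data.Bool.ListAction using (all)
open import Data.Bool.Properties using (T-≡; T-not-≡; T?)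
open import Data.Empty using (⊥; ⊥-elim)
open import Data.Fin using (Fin; zero; suc)
open import Data.Fin.Properties using (_≟_; injective⇒≤)
open import Data.Fin.Subset
  using (Subset; ∣_∣; _∈_; _∉_; _⊆_; _∪_; _∩_; _─_; _-_; ⁅_⁆; Nonempty; Empty)
  renaming (⊥ to ∅)
open import Data.Fin.Subset.Properties
  using (_∈?_; nonempty?; Empty-unique; ∉⊥; ⊥⊆; ∣⊥∣≡0; s⊆s; out⊆; ⊆-trans; ⊆-antisym; p⊆q⇒∣p∣≤∣q∣;
         x∈⁅x⁆; x∈⁅y⁆⇒x≡y; ∣⁅x⁆∣≡1; x∈p∪q⁻; x∈p∪q⁺; x∈p∩q⁻; x∈p∩q⁺; p∩q⊆p; p∩q⊆q;
         x∈p∧x∉q⇒x∈p─q; p─q⊆p; x∈p∧x≢y⇒x∈p-y)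
open import Data.List using (List; []; _∷_; map; length; filterᵇ; allFin)
import Data.List as List
open import Data.List.Membership.Propositional using (lose) renaming (_∈_ to _∈ₗ_)
open import Data.List.Membership.Propositional.Properties
  using (∈-lookup; ∈-map⁺; ∈-map⁻; ∈-++⁺ˡ; ∈-++⁺ʳ; ∈-filter⁺; ∈-filter⁻; ∈-allFin)
open import Data.List.Membership.Setoid.Properties using (index-injective)
open import Data.List.Properties using (filter-some)
import Data.List.Relation.Unary.All as All
open import Data.List.Relation.Unary.All.Properties using (all⁺; all⁻) renaming (tabulate⁺ to All-tabulate⁺)
open import Data.List.Relation.Unary.AllPairs using ([]; _∷_)
open import Data.List.Relation.Unary.Any using (here; index)
open import Data.List.Relation.Unary.Unique.Propositional using (Unique)
import Data.List.Relation.Unary.Unique.Propositional.Properties as Unique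
open import Data.Nat using (ℕ; zero; suc; _+_; _*_; _∸_; _^_; _≤_; _<_; z≤n; s≤s; _!; NonZero)
import Data.Nat as ℕ
open import Data.Nat.DivMod using (_/_; _%_; m≡m%n+[m/n]*n; m%n<n; m/n*n≤m; m≥n⇒m/n>0)
open import Data.Nat.Properties hiding (_≟_)
open import Algebra.Properties.Semiring.Sum +-*-semiring
  using (sum; sum-syntax; sum-cong-≗; sum-replicate-zero; ∑-distrib-+; *-distribˡ-sum; *-distribʳ-sum)
open import Data.Nat.Tactic.RingSolver using (solve-∀)
open import Data.Product using (_×_; _,_; proj₁; proj₂; ∃-syntax)
open import Data.Sum using (inj₁; inj₂)
open import Data.Vec using ([]; _∷_; here; there; lookup; tabulate)
open import Data.Vec.Properties using (∷-injectiveʳ; []=⇒lookup; lookup⇒[]=; lookup∘tabulate)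
open import Defs hiding (sym)
open import Function using (Equivalence; _∘_)
open import Relation.Binary.PropositionalEquality
  using (_≡_; _≢_; refl; sym; trans; cong; cong₂; subst; setoid; module ≡-Reasoning)
open import Relation.Nullary using (¬_; Dec; yes; no; contradiction)
open import Relation.Nullary.Decidable using (⌊_⌋; toWitness; fromWitness)

-- Counting subsets

module _ {A B : Set} where

  lookup-injective : ∀ {xs : List A} → Unique xs →
                     ∀ {i j} → List.lookup xs i ≡ List.lookup xs j → i ≡ j
  lookup-injective (_ ∷ _)       {zero}  {zero}  _ = refl
  lookup-injective (x≢xs ∷ _)    {zero}  {suc j} e = contradiction e (All.lookup x≢xs (∈-lookup j))
  lookup-injective (x≢xs ∷ _)    {suc i} {zero}  e = contradiction (sym e) (All.lookup x≢xs (∈-lookup i))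
  lookup-injective (_ ∷ unique) {suc i} {suc j} e = cong suc (lookup-injective unique e)

  length-≤-injection : (f : A → B) {xs : List A} {ys : List B} → Unique xs →
    (∀ {x y} → x ∈ₗ xs → y ∈ₗ xs → f x ≡ f y → x ≡ y) →
    (∀ {x} → x ∈ₗ xs → f x ∈ₗ ys) → length xs ≤ length ys
  length-≤-injection f {xs} {ys} unique f-injective f-into = injective⇒≤ position-injective
    where
    position : Fin (length xs) → Fin (length ys)
    position i = index (f-into (∈-lookup i))
    position-injective : ∀ {i j} → position i ≡ position j → i ≡ j
    position-injective e = lookup-injective unique
      (f-injective (∈-lookup _) (∈-lookup _) (index-injective (setoid B) (f-into _) (f-into _) e))

allSubsets-complete : ∀ {n} (S : Subset n) → S ∈ₗ allSubsets n
allSubsets-complete []          = here refl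
allSubsets-complete (true ∷ S)  = ∈-++⁺ˡ (∈-map⁺ (true ∷_) (allSubsets-complete S))
allSubsets-complete (false ∷ S) = ∈-++⁺ʳ _ (∈-map⁺ (false ∷_) (allSubsets-complete S))

allSubsets-unique : ∀ n → Unique (allSubsets n)
allSubsets-unique zero    = All.[] ∷ []
allSubsets-unique (suc n) =
  Unique.++⁺ (Unique.map⁺ ∷-injectiveʳ unique) (Unique.map⁺ ∷-injectiveʳ unique) true≢false
  where
  unique = allSubsets-unique n
  true≢false : ∀ {S} → S ∈ₗ map (true ∷_) (allSubsets n) × S ∈ₗ map (false ∷_) (allSubsets n) → ⊥
  true≢false (p , q) with ∈-map⁻ (true ∷_) p | ∈-map⁻ (false ∷_) q
  ... | _ , _ , refl | _ , _ , ()

indicator : Bool → ℕ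
indicator true  = 1
indicator false = 0

length-filterᵇ-∷ : ∀ {A : Set} (p : A → Bool) x xs →
  length (filterᵇ p (x ∷ xs)) ≡ indicator (p x) + length (filterᵇ p xs)
length-filterᵇ-∷ p x xs with p x
... | true  = refl
... | false = refl

sum-mono-≤ : ∀ {n} {f g : Fin n → ℕ} → (∀ i → f i ≤ g i) → sum f ≤ sum g
sum-mono-≤ {zero}  f≤g = z≤n
sum-mono-≤ {suc n} f≤g = +-mono-≤ (f≤g zero) (sum-mono-≤ (f≤g ∘ suc))

∑-indicator : ∀ {n} (S : Subset n) → ∑[ v < n ] indicator (lookup S v) ≡ ∣ S ∣
∑-indicator []          = refl
∑-indicator (true ∷ S)  = cong suc (∑-indicator S)
∑-indicator (false ∷ S) = ∑-indicator S

sumOver : ∀ {n} → Subset n → (Fin n → ℕ) → ℕ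
sumOver {n} U f = ∑[ v < n ] (indicator (lookup U v) * f v)

∣L∣*c≤d*sumOver : ∀ {n} {L U : Subset n} {c d} {f : Fin n → ℕ} → L ⊆ U →
  (∀ {v} → v ∈ L → c ≤ d * f v) → ∣ L ∣ * c ≤ d * sumOver U f
∣L∣*c≤d*sumOver {n} {L} {U} {c} {d} {f} L⊆U c≤d*f = begin
  ∣ L ∣ * c                                        ≡⟨ cong (_* c) (∑-indicator L) ⟨
  (∑[ v < n ] indicator (lookup L v)) * c          ≡⟨ *-distribʳ-sum c (λ v → indicator (lookup L v)) ⟩
  ∑[ v < n ] (indicator (lookup L v) * c)          ≤⟨ sum-mono-≤ pointwise ⟩
  ∑[ v < n ] (d * (indicator (lookup U v) * f v))  ≡⟨ *-distribˡ-sum d (λ v → indicator (lookup U v) * f v) ⟨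
  d * sumOver U f                                  ∎
  where
  open ≤-Reasoning
  pointwise : ∀ v → indicator (lookup L v) * c ≤ d * (indicator (lookup U v) * f v)
  pointwise v with lookup L v in v∈L
  ... | false = z≤n
  ... | true rewrite []=⇒lookup (L⊆U (lookup⇒[]= v L v∈L)) | *-identityˡ c | *-identityˡ (f v) =
    c≤d*f (lookup⇒[]= v L v∈L)

module _ {n : ℕ} where

  countSubsets : (Subset n → Bool) → ℕ
  countSubsets p = length (filterᵇ p (allSubsets n))

  countSubsets-pos : ∀ {p} S → p S ≡ true → 1 ≤ countSubsets p
  countSubsets-pos {p} S pS =
    filter-some (T? ∘ p) (lose (allSubsets-complete S) (Equivalence.from T-≡ pS))

  countSubsets-≤-injection : ∀ {p q} (f : Subset n → Subset n) →
    (∀ {S S′} → p S ≡ true → p S′ ≡ true → f S ≡ f S′ → S ≡ S′) →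
    (∀ {S} → p S ≡ true → q (f S) ≡ true) → countSubsets p ≤ countSubsets q
  countSubsets-≤-injection {p} {q} f f-injective f-into =
    length-≤-injection f (Unique.filter⁺ (T? ∘ p) (allSubsets-unique n))
      (λ S∈ S′∈ → f-injective (satisfies S∈) (satisfies S′∈))
      (λ S∈ → ∈-filter⁺ (T? ∘ q) (allSubsets-complete _) (Equivalence.from T-≡ (f-into (satisfies S∈))))
    where
    satisfies : ∀ {S} → S ∈ₗ filterᵇ p (allSubsets n) → p S ≡ true
    satisfies S∈ = Equivalence.to T-≡ (proj₂ (∈-filter⁻ (T? ∘ p) {xs = allSubsets n} S∈))

  ∑-length-filterᵇ-∋ : ∀ {s} (p : Subset n → Bool) → (∀ {S} → p S ≡ true → ∣ S ∣ ≡ s) →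
    ∀ Ss → ∑[ v < n ] length (filterᵇ (λ S → p S ∧ lookup S v) Ss) ≡ s * length (filterᵇ p Ss)
  ∑-length-filterᵇ-∋ {s} p size [] = trans (sum-replicate-zero n) (sym (*-zeroʳ s))
  ∑-length-filterᵇ-∋ {s} p size (S ∷ Ss) = begin
    ∑[ v < n ] length (filterᵇ (λ S → p S ∧ lookup S v) (S ∷ Ss))
      ≡⟨ sum-cong-≗ (λ v → length-filterᵇ-∷ (λ S → p S ∧ lookup S v) S Ss) ⟩
    ∑[ v < n ] (indicator (p S ∧ lookup S v) + length (filterᵇ (λ S → p S ∧ lookup S v) Ss))
      ≡⟨ ∑-distrib-+ (λ v → indicator (p S ∧ lookup S v)) _ ⟩
    ∑[ v < n ] indicator (p S ∧ lookup S v) + ∑[ v < n ] length (filterᵇ (λ S → p S ∧ lookup S v) Ss)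
      ≡⟨ cong₂ _+_ (∑-head (p S) refl) (∑-length-filterᵇ-∋ p size Ss) ⟩
    s * indicator (p S) + s * length (filterᵇ p Ss)
      ≡⟨ *-distribˡ-+ s (indicator (p S)) _ ⟨
    s * (indicator (p S) + length (filterᵇ p Ss))
      ≡⟨ cong (s *_) (length-filterᵇ-∷ p S Ss) ⟨
    s * length (filterᵇ p (S ∷ Ss))
      ∎
    where
    open ≡-Reasoning
    ∑-head : ∀ b → p S ≡ b → ∑[ v < n ] indicator (b ∧ lookup S v) ≡ s * indicator b
    ∑-head true  pS = trans (∑-indicator S) (trans (size pS) (sym (*-identityʳ s)))
    ∑-head false _  = trans (sum-replicate-zero n) (sym (*-zeroʳ s))

  ∑-countSubsets-∋ : ∀ {s} (p : Subset n → Bool) → (∀ {S} → p S ≡ true → ∣ S ∣ ≡ s) →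
    ∑[ v < n ] countSubsets (λ S → p S ∧ lookup S v) ≡ s * countSubsets p
  ∑-countSubsets-∋ p size = ∑-length-filterᵇ-∋ p size (allSubsets n)

∣p∪q∣+∣p∩q∣≡∣p∣+∣q∣ : ∀ {n} (p q : Subset n) → ∣ p ∪ q ∣ + ∣ p ∩ q ∣ ≡ ∣ p ∣ + ∣ q ∣
∣p∪q∣+∣p∩q∣≡∣p∣+∣q∣ []          []          = refl
∣p∪q∣+∣p∩q∣≡∣p∣+∣q∣ (true ∷ p)  (true ∷ q)  = cong suc (begin
  ∣ p ∪ q ∣ + suc ∣ p ∩ q ∣    ≡⟨ +-suc ∣ p ∪ q ∣ ∣ p ∩ q ∣ ⟩
  suc (∣ p ∪ q ∣ + ∣ p ∩ q ∣)  ≡⟨ cong suc (∣p∪q∣+∣p∩q∣≡∣p∣+∣q∣ p q) ⟩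
  suc (∣ p ∣ + ∣ q ∣)          ≡⟨ +-suc ∣ p ∣ ∣ q ∣ ⟨
  ∣ p ∣ + suc ∣ q ∣            ∎)
  where open ≡-Reasoning
∣p∪q∣+∣p∩q∣≡∣p∣+∣q∣ (true ∷ p)  (false ∷ q) = cong suc (∣p∪q∣+∣p∩q∣≡∣p∣+∣q∣ p q)
∣p∪q∣+∣p∩q∣≡∣p∣+∣q∣ (false ∷ p) (true ∷ q)  =
  trans (cong suc (∣p∪q∣+∣p∩q∣≡∣p∣+∣q∣ p q)) (sym (+-suc ∣ p ∣ ∣ q ∣))
∣p∪q∣+∣p∩q∣≡∣p∣+∣q∣ (false ∷ p) (false ∷ q) = ∣p∪q∣+∣p∩q∣≡∣p∣+∣q∣ p q

∣p∪q∣≤∣p∣+∣q∣ : ∀ {n} (p q : Subset n) → ∣ p ∪ q ∣ ≤ ∣ p ∣ + ∣ q ∣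
∣p∪q∣≤∣p∣+∣q∣ p q = ≤-trans (m≤m+n ∣ p ∪ q ∣ ∣ p ∩ q ∣) (≤-reflexive (∣p∪q∣+∣p∩q∣≡∣p∣+∣q∣ p q))

disjoint⇒∣p∪q∣≡∣p∣+∣q∣ : ∀ {n} (p q : Subset n) → (∀ {x} → x ∈ p → x ∉ q) → ∣ p ∪ q ∣ ≡ ∣ p ∣ + ∣ q ∣
disjoint⇒∣p∪q∣≡∣p∣+∣q∣ {n} p q p∩q=∅ = begin
  ∣ p ∪ q ∣              ≡⟨ +-identityʳ ∣ p ∪ q ∣ ⟨
  ∣ p ∪ q ∣ + 0          ≡⟨ cong (∣ p ∪ q ∣ +_) (trans (cong ∣_∣ (Empty-unique p∩q-empty)) (∣⊥∣≡0 n)) ⟨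
  ∣ p ∪ q ∣ + ∣ p ∩ q ∣  ≡⟨ ∣p∪q∣+∣p∩q∣≡∣p∣+∣q∣ p q ⟩
  ∣ p ∣ + ∣ q ∣          ∎
  where
  open ≡-Reasoning
  p∩q-empty : Empty (p ∩ q)
  p∩q-empty (x , x∈p∩q) = let x∈p , x∈q = x∈p∩q⁻ p q x∈p∩q in p∩q=∅ x∈p x∈q

x∉p⇒∣p∪⁅x⁆∣≡1+∣p∣ : ∀ {n x} (p : Subset n) → x ∉ p → ∣ p ∪ ⁅ x ⁆ ∣ ≡ suc ∣ p ∣
x∉p⇒∣p∪⁅x⁆∣≡1+∣p∣ {x = x} p x∉p = begin
  ∣ p ∪ ⁅ x ⁆ ∣      ≡⟨ disjoint⇒∣p∪q∣≡∣p∣+∣q∣ p ⁅ x ⁆ p∌x ⟩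
  ∣ p ∣ + ∣ ⁅ x ⁆ ∣  ≡⟨ cong (∣ p ∣ +_) (∣⁅x⁆∣≡1 x) ⟩
  ∣ p ∣ + 1          ≡⟨ +-comm ∣ p ∣ 1 ⟩
  suc ∣ p ∣          ∎
  where
  open ≡-Reasoning
  p∌x : ∀ {y} → y ∈ p → y ∉ ⁅ x ⁆
  p∌x y∈p y∈⁅x⁆ = x∉p (subst (_∈ p) (x∈⁅y⁆⇒x≡y x y∈⁅x⁆) y∈p)

∪⁅x⁆-injective : ∀ {n x} {p q : Subset n} → x ∉ p → x ∉ q → p ∪ ⁅ x ⁆ ≡ q ∪ ⁅ x ⁆ → p ≡ q
∪⁅x⁆-injective {x = x} x∉p x∉q eq = ⊆-antisym (cancel x∉p eq) (cancel x∉q (sym eq))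
  where
  cancel : ∀ {p q} → x ∉ p → p ∪ ⁅ x ⁆ ≡ q ∪ ⁅ x ⁆ → p ⊆ q
  cancel {p} {q} x∉p eq {y} y∈p with x∈p∪q⁻ q ⁅ x ⁆ (subst (y ∈_) eq (x∈p∪q⁺ (inj₁ y∈p)))
  ... | inj₁ y∈q = y∈q
  ... | inj₂ y∈x = contradiction (subst (_∈ p) (x∈⁅y⁆⇒x≡y x y∈x) y∈p) x∉p

x∈p─q⇒x∉q : ∀ {n} (p q : Subset n) {x} → x ∈ p ─ q → x ∉ q
x∈p─q⇒x∉q (_ ∷ p) (false ∷ q) here       ()
x∈p─q⇒x∉q (_ ∷ p) (_     ∷ q) (there x∈) (there x∈q) = x∈p─q⇒x∉q p q x∈ x∈q

∣p∣>0⇒Nonempty : ∀ {n} (p : Subset n) → 0 < ∣ p ∣ → Nonempty p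
∣p∣>0⇒Nonempty {n} p 0<∣p∣ with nonempty? p
... | yes p-nonempty = p-nonempty
... | no  p-empty    =
  contradiction (subst (0 <_) (trans (cong ∣_∣ (Empty-unique p-empty)) (∣⊥∣≡0 n)) 0<∣p∣) (λ ())

∃⊆-with-size : ∀ {n} k (p : Subset n) → k ≤ ∣ p ∣ → ∃[ q ] (q ⊆ p × ∣ q ∣ ≡ k)
∃⊆-with-size {n} zero p _ = ∅ , ⊥⊆ , ∣⊥∣≡0 n
∃⊆-with-size (suc k) (true ∷ p)  (s≤s k≤∣p∣) =
  let q , q⊆p , ∣q∣≡k = ∃⊆-with-size k p k≤∣p∣ in true ∷ q , s⊆s q⊆p , cong suc ∣q∣≡k
∃⊆-with-size (suc k) (false ∷ p) k≤∣p∣ =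
  let q , q⊆p , ∣q∣≡k = ∃⊆-with-size (suc k) p k≤∣p∣ in false ∷ q , out⊆ q⊆p , ∣q∣≡k

∈-tabulate⁺ : ∀ {n} {f : Fin n → Bool} {x} → f x ≡ true → x ∈ tabulate f
∈-tabulate⁺ {f = f} {x} fx = lookup⇒[]= x (tabulate f) (trans (lookup∘tabulate f x) fx)

∈-tabulate⁻ : ∀ {n} {f : Fin n → Bool} {x} → x ∈ tabulate f → f x ≡ true
∈-tabulate⁻ {f = f} {x} x∈ = trans (sym (lookup∘tabulate f x)) ([]=⇒lookup x∈)

embed : ∀ {n} (S : Subset n) → Fin ∣ S ∣ → Fin n
embed (true ∷ S)  zero    = zero
embed (true ∷ S)  (suc i) = suc (embed S i)
embed (false ∷ S) i       = suc (embed S i)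

embedSubset : ∀ {n} (S : Subset n) → Subset ∣ S ∣ → Subset n
embedSubset []          []      = []
embedSubset (true ∷ S)  (b ∷ T) = b ∷ embedSubset S T
embedSubset (false ∷ S) T       = false ∷ embedSubset S T

∣embedSubset∣ : ∀ {n} (S : Subset n) T → ∣ embedSubset S T ∣ ≡ ∣ T ∣
∣embedSubset∣ []          []          = refl
∣embedSubset∣ (true ∷ S)  (true ∷ T)  = cong suc (∣embedSubset∣ S T)
∣embedSubset∣ (true ∷ S)  (false ∷ T) = ∣embedSubset∣ S T
∣embedSubset∣ (false ∷ S) T           = ∣embedSubset∣ S T

embedSubset⊆ : ∀ {n} (S : Subset n) T → embedSubset S T ⊆ S
embedSubset⊆ (true ∷ S)  (true ∷ T) here       = here
embedSubset⊆ (true ∷ S)  (_ ∷ T)    (there x∈) = there (embedSubset⊆ S T x∈)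
embedSubset⊆ (false ∷ S) T          (there x∈) = there (embedSubset⊆ S T x∈)

∈embedSubset⁻ : ∀ {n} (S : Subset n) T {x} → x ∈ embedSubset S T → ∃[ i ] (i ∈ T × embed S i ≡ x)
∈embedSubset⁻ (true ∷ S)  (true ∷ T) here       = zero , here , refl
∈embedSubset⁻ (true ∷ S)  (_ ∷ T)    (there x∈) =
  let i , i∈T , eq = ∈embedSubset⁻ S T x∈ in suc i , there i∈T , cong suc eq
∈embedSubset⁻ (false ∷ S) T          (there x∈) =
  let i , i∈T , eq = ∈embedSubset⁻ S T x∈ in i , i∈T , cong suc eq

⌊⌋≡true⁺ : ∀ {A : Set} (d : Dec A) → A → ⌊ d ⌋ ≡ true
⌊⌋≡true⁺ d a = Equivalence.to T-≡ (fromWitness {a? = d} a)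

⌊⌋≡true⁻ : ∀ {A : Set} (d : Dec A) → ⌊ d ⌋ ≡ true → A
⌊⌋≡true⁻ d h = toWitness {a? = d} (Equivalence.from T-≡ h)

∧≡true⁻ : ∀ {a b} → a ∧ b ≡ true → a ≡ true × b ≡ true
∧≡true⁻ {true} {true} _ = refl , refl

all-allFin⁻ : ∀ {n} {p : Fin n → Bool} → all p (allFin n) ≡ true → ∀ i → p i ≡ true
all-allFin⁻ {n} {p} h i =
  Equivalence.to T-≡ (All.lookup (all⁺ p (allFin n) (Equivalence.from T-≡ h)) (∈-allFin i))

all-allFin⁺ : ∀ {n} {p : Fin n → Bool} → (∀ i → p i ≡ true) → all p (allFin n) ≡ true
all-allFin⁺ {p = p} h = Equivalence.to T-≡ (all⁻ p (All-tabulate⁺ (λ i → Equivalence.from T-≡ (h i))))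

-- Arithmetic

triangular : ℕ → ℕ
triangular zero    = 0
triangular (suc s) = s + triangular s

triangular-suc+triangular : ∀ s → triangular (suc s) + triangular s ≡ s * s
triangular-suc+triangular zero    = refl
triangular-suc+triangular (suc s) = begin
  suc s + (s + triangular s) + (s + triangular s)  ≡⟨ regroup (suc s) s (triangular s) ⟩
  suc s + s + (s + triangular s + triangular s)    ≡⟨ cong (suc s + s +_) (triangular-suc+triangular s) ⟩
  suc s + s + s * s                                ≡⟨ square s ⟩
  suc s * suc s                                    ∎
  where
  open ≡-Reasoning
  regroup : ∀ x s T → x + (s + T) + (s + T) ≡ x + s + (s + T + T)
  regroup = solve-∀
  square : ∀ s → suc s + s + s * s ≡ suc s * suc s
  square = solve-∀

suc≤⇒suc≤^ : ∀ {b} s → suc s ≤ b → suc s ≤ b ^ s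
suc≤⇒suc≤^ zero _ = ≤-refl
suc≤⇒suc≤^ {b} (suc s) 2+s≤b = begin
  suc (suc s)  ≤⟨ 2+s≤b ⟩
  b            ≤⟨ m≤m*n b (suc s) ⟩
  b * suc s    ≤⟨ *-monoʳ-≤ b (suc≤⇒suc≤^ s (≤-trans (n≤1+n _) 2+s≤b)) ⟩
  b * b ^ s    ∎
  where open ≤-Reasoning

!≤^triangular : ∀ {b} s → s ≤ b → s ! ≤ b ^ triangular s
!≤^triangular zero    _ = ≤-refl
!≤^triangular {b} (suc s) 1+s≤b = begin
  suc s * s !               ≤⟨ *-mono-≤ (suc≤⇒suc≤^ s 1+s≤b) (!≤^triangular s (≤-trans (n≤1+n s) 1+s≤b)) ⟩
  b ^ s * b ^ triangular s  ≡⟨ ^-distribˡ-+-* b s (triangular s) ⟨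
  b ^ triangular (suc s)    ∎
  where open ≤-Reasoning

^triangular*!≤^square : ∀ {a b} s → a ≤ b → s ≤ b → a ^ triangular (suc s) * s ! ≤ b ^ (s * s)
^triangular*!≤^square {a} {b} s a≤b s≤b = begin
  a ^ triangular (suc s) * s !               ≤⟨ *-mono-≤ (^-monoˡ-≤ (triangular (suc s)) a≤b) (!≤^triangular s s≤b) ⟩
  b ^ triangular (suc s) * b ^ triangular s  ≡⟨ ^-distribˡ-+-* b (triangular (suc s)) (triangular s) ⟨
  b ^ (triangular (suc s) + triangular s)    ≡⟨ cong (b ^_) (triangular-suc+triangular s) ⟩
  b ^ (s * s)                                ∎
  where open ≤-Reasoning

^-distrib-* : ∀ x y n → (x * y) ^ n ≡ x ^ n * y ^ n
^-distrib-* x y zero    = refl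
^-distrib-* x y (suc n) = trans (cong (x * y *_) (^-distrib-* x y n)) (interchange x y (x ^ n) (y ^ n))
  where
  interchange : ∀ x y X Y → x * y * (X * Y) ≡ x * X * (y * Y)
  interchange = solve-∀

∃k[q*k≤d≤2*q*k] : ∀ q d .{{_ : NonZero q}} → q ≤ d → ∃[ k ] (q * k ≤ d × d ≤ 2 * (q * k))
∃k[q*k≤d≤2*q*k] q d q≤d = k , ≤-trans (≤-reflexive (*-comm q k)) (m/n*n≤m d q) , d≤2*q*k
  where
  open ≤-Reasoning
  k = d / q
  q≤q*k : q ≤ q * k
  q≤q*k = ≤-trans (≤-reflexive (sym (*-identityʳ q))) (*-monoʳ-≤ q (m≥n⇒m/n>0 q≤d))
  d≤2*q*k : d ≤ 2 * (q * k)
  d≤2*q*k = begin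
    d              ≡⟨ m≡m%n+[m/n]*n d q ⟩
    d % q + k * q  ≤⟨ +-mono-≤ (<⇒≤ (m%n<n d q)) (≤-reflexive (*-comm k q)) ⟩
    q + q * k      ≤⟨ +-monoˡ-≤ (q * k) q≤q*k ⟩
    q * k + q * k  ≡⟨ cong (q * k +_) (+-identityʳ (q * k)) ⟨
    2 * (q * k)    ∎

d^s≤-when-a^s≤d : ∀ {a b s d k I} → a ≤ b → s ≤ b → d ≤ 2 * (a ^ s * k) →
                  k ^ s * a ^ triangular s ≤ s ! * I → d ^ s ≤ I * (2 * b ^ s) ^ s
d^s≤-when-a^s≤d {a} {b} {s} {d} {k} {I} a≤b s≤b d≤2*a^s*k counted = begin
  d ^ s                        ≤⟨ ^-monoˡ-≤ s d≤2*a^s*k ⟩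
  (2 * (a ^ s * k)) ^ s        ≡⟨ expand ⟩
  2 ^ s * (A₁ * (k ^ s * A₀))  ≤⟨ *-monoʳ-≤ (2 ^ s) (*-monoʳ-≤ A₁ counted) ⟩
  2 ^ s * (A₁ * (s ! * I))     ≡⟨ reassoc (2 ^ s) A₁ (s !) I ⟩
  2 ^ s * (A₁ * s !) * I       ≤⟨ *-monoˡ-≤ I (*-monoʳ-≤ (2 ^ s) (^triangular*!≤^square s a≤b s≤b)) ⟩
  2 ^ s * b ^ (s * s) * I      ≡⟨ collapse ⟩
  I * (2 * b ^ s) ^ s          ∎
  where
  open ≤-Reasoning
  A₁ = a ^ triangular (suc s)
  A₀ = a ^ triangular s
  reassoc : ∀ x y z w → x * (y * (z * w)) ≡ x * (y * z) * w
  reassoc = solve-∀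
  shuffle : ∀ x y z w → x * (y * z * w) ≡ x * (y * (w * z))
  shuffle = solve-∀
  [a^s]^s≡A₁*A₀ : (a ^ s) ^ s ≡ A₁ * A₀
  [a^s]^s≡A₁*A₀ = trans (^-*-assoc a s s) (trans (cong (a ^_) (sym (triangular-suc+triangular s)))
                                                 (^-distribˡ-+-* a (triangular (suc s)) (triangular s)))
  expand : (2 * (a ^ s * k)) ^ s ≡ 2 ^ s * (A₁ * (k ^ s * A₀))
  expand = begin-equality
    (2 * (a ^ s * k)) ^ s          ≡⟨ ^-distrib-* 2 (a ^ s * k) s ⟩
    2 ^ s * (a ^ s * k) ^ s        ≡⟨ cong (2 ^ s *_) (^-distrib-* (a ^ s) k s) ⟩
    2 ^ s * ((a ^ s) ^ s * k ^ s)  ≡⟨ cong (λ x → 2 ^ s * (x * k ^ s)) [a^s]^s≡A₁*A₀ ⟩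
    2 ^ s * (A₁ * A₀ * k ^ s)      ≡⟨ shuffle (2 ^ s) A₁ A₀ (k ^ s) ⟩
    2 ^ s * (A₁ * (k ^ s * A₀))    ∎
  collapse : 2 ^ s * b ^ (s * s) * I ≡ I * (2 * b ^ s) ^ s
  collapse = begin-equality
    2 ^ s * b ^ (s * s) * I    ≡⟨ *-comm (2 ^ s * b ^ (s * s)) I ⟩
    I * (2 ^ s * b ^ (s * s))  ≡⟨ cong (λ x → I * (2 ^ s * x)) (^-*-assoc b s s) ⟨
    I * (2 ^ s * (b ^ s) ^ s)  ≡⟨ cong (I *_) (^-distrib-* 2 (b ^ s) s) ⟨
    I * (2 * b ^ s) ^ s        ∎

d^s≤-when-d<a^s : ∀ {a b s d I} → a ≤ b → d < a ^ s → 1 ≤ I → d ^ s ≤ I * (2 * b ^ s) ^ s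
d^s≤-when-d<a^s {a} {b} {s} {d} {I} a≤b d<a^s 1≤I = begin
  d ^ s                ≤⟨ ^-monoˡ-≤ s (<⇒≤ d<a^s) ⟩
  (a ^ s) ^ s          ≤⟨ ^-monoˡ-≤ s (^-monoˡ-≤ s a≤b) ⟩
  (b ^ s) ^ s          ≤⟨ ^-monoˡ-≤ s (m≤n*m (b ^ s) 2) ⟩
  (2 * b ^ s) ^ s      ≡⟨ *-identityˡ _ ⟨
  1 * (2 * b ^ s) ^ s  ≤⟨ *-monoˡ-≤ _ 1≤I ⟩
  I * (2 * b ^ s) ^ s  ∎
  where open ≤-Reasoning

-- Cliques and independent sets

module _ {n : ℕ} (G : Graph n) where

  Nbhd : Fin n → Subset n
  Nbhd v = tabulate (adj G v)

  nonNbhdIn : Subset n → Fin n → Subset n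
  nonNbhdIn U v = U ─ Nbhd v - v

  IsClique : Subset n → Set
  IsClique S = ∀ {x y} → x ∈ S → y ∈ S → x ≢ y → adj G x y ≡ true

  IsIndependent : Subset n → Set
  IsIndependent S = ∀ {x y} → x ∈ S → y ∈ S → adj G x y ≡ false

  CliqueFree : ℕ → Subset n → Set
  CliqueFree k U = ∀ {K} → K ⊆ U → ∣ K ∣ ≡ k → ¬ IsClique K

  IndepSetIn : Subset n → ℕ → Subset n → Set
  IndepSetIn U s S = S ⊆ U × IsIndependent S × ∣ S ∣ ≡ s

  -- numIndepInNbhd G X is numIndepIn (commonNbhd G X) by definition.
  isIndepSetIn : Subset n → ℕ → Subset n → Bool
  isIndepSetIn U s S = subsetOf G S U ∧ isIndep G S ∧ ⌊ ∣ S ∣ ℕ.≟ s ⌋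

  numIndepIn : Subset n → ℕ → ℕ
  numIndepIn U s = countSubsets (isIndepSetIn U s)

  isClique-sound : ∀ {S} → isClique G S ≡ true → IsClique S
  isClique-sound {S} h {x} {y} x∈S y∈S x≢y with x ≟ y | all-allFin⁻ (all-allFin⁻ h x) y
  ... | yes x≡y | _ = contradiction x≡y x≢y
  ... | no _    | e rewrite []=⇒lookup x∈S | []=⇒lookup y∈S = e

  isClique-complete : ∀ {S} → IsClique S → isClique G S ≡ true
  isClique-complete {S} h = all-allFin⁺ λ x → all-allFin⁺ λ y → pair x y
    where
    pair : ∀ x y → (not (lookup S x ∧ lookup S y) ∨ ⌊ x ≟ y ⌋ ∨ adj G x y) ≡ true
    pair x y with lookup S x in x∈S | lookup S y in y∈S | x ≟ y
    ... | false | _     | _      = refl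
    ... | true  | false | _      = refl
    ... | true  | true  | yes _  = refl
    ... | true  | true  | no x≢y = h (lookup⇒[]= x S x∈S) (lookup⇒[]= y S y∈S) x≢y

  isIndep-sound : ∀ {S} → isIndep G S ≡ true → IsIndependent S
  isIndep-sound {S} h {x} {y} x∈S y∈S with all-allFin⁻ (all-allFin⁻ h x) y
  ... | e rewrite []=⇒lookup x∈S | []=⇒lookup y∈S = Equivalence.to T-not-≡ (Equivalence.from T-≡ e)

  isIndep-complete : ∀ {S} → IsIndependent S → isIndep G S ≡ true
  isIndep-complete {S} h = all-allFin⁺ λ x → all-allFin⁺ λ y → pair x y
    where
    pair : ∀ x y → (not (lookup S x ∧ lookup S y) ∨ not (adj G x y)) ≡ true
    pair x y with lookup S x in x∈S | lookup S y in y∈S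
    ... | false | _     = refl
    ... | true  | false = refl
    ... | true  | true  rewrite h (lookup⇒[]= x S x∈S) (lookup⇒[]= y S y∈S) = refl

  subsetOf-sound : ∀ {S U} → subsetOf G S U ≡ true → S ⊆ U
  subsetOf-sound {S} {U} h {x} x∈S with all-allFin⁻ h x
  ... | e rewrite []=⇒lookup x∈S = lookup⇒[]= x U e

  subsetOf-complete : ∀ {S U} → S ⊆ U → subsetOf G S U ≡ true
  subsetOf-complete {S} {U} S⊆U = all-allFin⁺ member
    where
    member : ∀ x → (not (lookup S x) ∨ lookup U x) ≡ true
    member x with lookup S x in x∈S
    ... | false = refl
    ... | true  = []=⇒lookup (S⊆U (lookup⇒[]= x S x∈S))

  isIndepSetIn-sound : ∀ U s S → isIndepSetIn U s S ≡ true → IndepSetIn U s S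
  isIndepSetIn-sound U s S h =
    let S⊆U , rest = ∧≡true⁻ {subsetOf G S U} h
        S-indep , ∣S∣≡s = ∧≡true⁻ {isIndep G S} rest
    in subsetOf-sound S⊆U , isIndep-sound S-indep , ⌊⌋≡true⁻ (∣ S ∣ ℕ.≟ s) ∣S∣≡s

  isIndepSetIn-complete : ∀ U s S → IndepSetIn U s S → isIndepSetIn U s S ≡ true
  isIndepSetIn-complete U s S (S⊆U , S-indep , ∣S∣≡s)
    rewrite subsetOf-complete S⊆U | isIndep-complete S-indep = ⌊⌋≡true⁺ (∣ S ∣ ℕ.≟ s) ∣S∣≡s

  ∈commonNbhd⇒adj : ∀ {X v x} → v ∈ commonNbhd G X → x ∈ X → adj G x v ≡ true
  ∈commonNbhd⇒adj {X} {v} {x} v∈N x∈X with all-allFin⁻ (∈-tabulate⁻ v∈N) x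
  ... | e rewrite []=⇒lookup x∈X = e

  v∉Nbhd[v] : ∀ v → v ∉ Nbhd v
  v∉Nbhd[v] v v∈N = contradiction (trans (sym (∈-tabulate⁻ v∈N)) (irrefl G v)) λ ()

  nonNbhdIn⊆ : ∀ U v → nonNbhdIn U v ⊆ U
  nonNbhdIn⊆ U v w∈ = p─q⊆p U (Nbhd v) (p─q⊆p (U ─ Nbhd v) ⁅ v ⁆ w∈)

  ∈nonNbhdIn⇒≁ : ∀ {U v w} → w ∈ nonNbhdIn U v → adj G v w ≡ false
  ∈nonNbhdIn⇒≁ {U} {v} {w} w∈ with adj G v w in e
  ... | false = refl
  ... | true  = contradiction (∈-tabulate⁺ e) (x∈p─q⇒x∉q U (Nbhd v) (p─q⊆p (U ─ Nbhd v) ⁅ v ⁆ w∈))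

  v∉nonNbhdIn : ∀ U v → v ∉ nonNbhdIn U v
  v∉nonNbhdIn U v v∈ = x∈p─q⇒x∉q (U ─ Nbhd v) ⁅ v ⁆ v∈ (x∈⁅x⁆ v)

  ∈nonNbhdIn⁺ : ∀ {U v w} → w ∈ U → adj G v w ≡ false → w ≢ v → w ∈ nonNbhdIn U v
  ∈nonNbhdIn⁺ w∈U v≁w w≢v =
    x∈p∧x≢y⇒x∈p-y (x∈p∧x∉q⇒x∈p─q w∈U (λ w∈N → contradiction (trans (sym (∈-tabulate⁻ w∈N)) v≁w) λ ())) w≢v

  clique-⊆ : ∀ {P Q} → P ⊆ Q → IsClique Q → IsClique P
  clique-⊆ P⊆Q Q-clique x∈ y∈ = Q-clique (P⊆Q x∈) (P⊆Q y∈)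

  cliqueFree-⊆ : ∀ {k U V} → V ⊆ U → CliqueFree k U → CliqueFree k V
  cliqueFree-⊆ V⊆U U-free K⊆V = U-free (⊆-trans K⊆V V⊆U)

  clique-∪ : ∀ {P Q} → IsClique P → IsClique Q → (∀ {x y} → x ∈ P → y ∈ Q → adj G x y ≡ true) →
             IsClique (P ∪ Q)
  clique-∪ {P} {Q} P-clique Q-clique P~Q x∈ y∈ x≢y with x∈p∪q⁻ P Q x∈ | x∈p∪q⁻ P Q y∈
  ... | inj₁ x∈P | inj₁ y∈P = P-clique x∈P y∈P x≢y
  ... | inj₁ x∈P | inj₂ y∈Q = P~Q x∈P y∈Q
  ... | inj₂ x∈Q | inj₁ y∈P = trans (Graph.sym G _ _) (P~Q y∈P x∈Q)
  ... | inj₂ x∈Q | inj₂ y∈Q = Q-clique x∈Q y∈Q x≢y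

  independent-∪ : ∀ {P Q} → IsIndependent P → IsIndependent Q →
                  (∀ {x y} → x ∈ P → y ∈ Q → adj G x y ≡ false) → IsIndependent (P ∪ Q)
  independent-∪ {P} {Q} P-indep Q-indep P≁Q x∈ y∈ with x∈p∪q⁻ P Q x∈ | x∈p∪q⁻ P Q y∈
  ... | inj₁ x∈P | inj₁ y∈P = P-indep x∈P y∈P
  ... | inj₁ x∈P | inj₂ y∈Q = P≁Q x∈P y∈Q
  ... | inj₂ x∈Q | inj₁ y∈P = trans (Graph.sym G _ _) (P≁Q y∈P x∈Q)
  ... | inj₂ x∈Q | inj₂ y∈Q = Q-indep x∈Q y∈Q

  ⁅⁆-clique : ∀ v → IsClique ⁅ v ⁆
  ⁅⁆-clique v x∈ y∈ x≢y = contradiction (trans (x∈⁅y⁆⇒x≡y v x∈) (sym (x∈⁅y⁆⇒x≡y v y∈))) x≢y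

  ⁅⁆-independent : ∀ v → IsIndependent ⁅ v ⁆
  ⁅⁆-independent v x∈ y∈ rewrite x∈⁅y⁆⇒x≡y v x∈ | x∈⁅y⁆⇒x≡y v y∈ = irrefl G v

  cliqueFree-commonNbhd : ∀ {r a X} → ¬ HasClique G r → IsClique X → r ≤ ∣ X ∣ + a →
                          CliqueFree a (commonNbhd G X)
  cliqueFree-commonNbhd {r} {a} {X} no-Kr X-clique r≤∣X∣+a {K} K⊆N ∣K∣≡a K-clique =
    let R , R⊆X∪K , ∣R∣≡r = ∃⊆-with-size r (X ∪ K) (subst (r ≤_) (sym ∣X∪K∣≡∣X∣+a) r≤∣X∣+a)
    in no-Kr (R , ∣R∣≡r , isClique-complete (clique-⊆ R⊆X∪K (clique-∪ X-clique K-clique X~K)))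
    where
    X~K : ∀ {x y} → x ∈ X → y ∈ K → adj G x y ≡ true
    X~K x∈X y∈K = ∈commonNbhd⇒adj (K⊆N y∈K) x∈X
    ∣X∪K∣≡∣X∣+a : ∣ X ∪ K ∣ ≡ ∣ X ∣ + a
    ∣X∪K∣≡∣X∣+a = trans
      (disjoint⇒∣p∪q∣≡∣p∣+∣q∣ X K λ x∈X x∈K → contradiction (trans (sym (X~K x∈X x∈K)) (irrefl G _)) λ ())
      (cong (∣ X ∣ +_) ∣K∣≡a)

  induced : (S : Subset n) → Graph ∣ S ∣
  induced S = record
    { adj    = λ i j → adj G (embed S i) (embed S j)
    ; sym    = λ i j → Graph.sym G (embed S i) (embed S j)
    ; irrefl = λ i → irrefl G (embed S i)
    }

  ∣W∣≤1+∣W∩Nbhd∣+∣nonNbhdIn∣ : ∀ {U W} v → W ⊆ U →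
    ∣ W ∣ ≤ suc (∣ W ∩ Nbhd v ∣ + ∣ nonNbhdIn U v ∣)
  ∣W∣≤1+∣W∩Nbhd∣+∣nonNbhdIn∣ {U} {W} v W⊆U = begin
    ∣ W ∣                                     ≤⟨ p⊆q⇒∣p∣≤∣q∣ cover ⟩
    ∣ ⁅ v ⁆ ∪ (W ∩ Nbhd v ∪ nonNbhdIn U v) ∣   ≤⟨ ∣p∪q∣≤∣p∣+∣q∣ ⁅ v ⁆ _ ⟩
    ∣ ⁅ v ⁆ ∣ + ∣ W ∩ Nbhd v ∪ nonNbhdIn U v ∣
      ≤⟨ +-mono-≤ (≤-reflexive (∣⁅x⁆∣≡1 v)) (∣p∪q∣≤∣p∣+∣q∣ (W ∩ Nbhd v) (nonNbhdIn U v)) ⟩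
    suc (∣ W ∩ Nbhd v ∣ + ∣ nonNbhdIn U v ∣)   ∎
    where
    open ≤-Reasoning
    cover : W ⊆ ⁅ v ⁆ ∪ (W ∩ Nbhd v ∪ nonNbhdIn U v)
    cover {w} w∈W with w ≟ v | adj G v w in e
    ... | yes refl | _     = x∈p∪q⁺ (inj₁ (x∈⁅x⁆ v))
    ... | no  w≢v  | true  = x∈p∪q⁺ (inj₂ (x∈p∪q⁺ (inj₁ (x∈p∩q⁺ (w∈W , ∈-tabulate⁺ e)))))
    ... | no  w≢v  | false = x∈p∪q⁺ (inj₂ (x∈p∪q⁺ (inj₂ (∈nonNbhdIn⁺ (W⊆U w∈W) e w≢v))))

  ∣W∩Nbhd∣>j*t : ∀ {U W t v} j → W ⊆ U → v ∈ W → (∀ {v} → v ∈ W → ∣ nonNbhdIn U v ∣ < t) →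
                  suc j * t < ∣ W ∣ → j * t < ∣ W ∩ Nbhd v ∣
  ∣W∩Nbhd∣>j*t {U} {W} {t} {v} j W⊆U v∈W few [1+j]t<∣W∣ =
    +-cancelʳ-< t (j * t) ∣ W ∩ Nbhd v ∣ (begin-strict
      j * t + t                                ≡⟨ +-comm (j * t) t ⟩
      t + j * t                                ≤⟨ ≤-pred (≤-trans [1+j]t<∣W∣ (∣W∣≤1+∣W∩Nbhd∣+∣nonNbhdIn∣ v W⊆U)) ⟩
      ∣ W ∩ Nbhd v ∣ + ∣ nonNbhdIn U v ∣        <⟨ +-monoʳ-< ∣ W ∩ Nbhd v ∣ (few v∈W) ⟩
      ∣ W ∩ Nbhd v ∣ + t                        ∎)
    where open ≤-Reasoning

  greedy-clique : ∀ {U t} j {W} → W ⊆ U → (∀ {v} → v ∈ W → ∣ nonNbhdIn U v ∣ < t) →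
                  j * t < ∣ W ∣ → ∃[ K ] (K ⊆ W × ∣ K ∣ ≡ suc j × IsClique K)
  greedy-clique zero {W} _ _ 0<∣W∣ =
    let v , v∈W = ∣p∣>0⇒Nonempty W 0<∣W∣
    in ⁅ v ⁆ , (λ x∈ → subst (_∈ W) (sym (x∈⁅y⁆⇒x≡y v x∈)) v∈W) , ∣⁅x⁆∣≡1 v , ⁅⁆-clique v
  greedy-clique (suc j) {W} W⊆U few [1+j]t<∣W∣
    with v , v∈W ← ∣p∣>0⇒Nonempty W (≤-<-trans z≤n [1+j]t<∣W∣)
    with K , K⊆W∩N , ∣K∣≡1+j , K-clique ←
           greedy-clique j (⊆-trans (p∩q⊆p W (Nbhd v)) W⊆U) (λ x∈ → few (p∩q⊆p W (Nbhd v) x∈))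
                         (∣W∩Nbhd∣>j*t j W⊆U v∈W few [1+j]t<∣W∣)
    = K ∪ ⁅ v ⁆ , K∪v⊆W , trans (x∉p⇒∣p∪⁅x⁆∣≡1+∣p∣ K v∉K) (cong suc ∣K∣≡1+j) ,
      clique-∪ K-clique (⁅⁆-clique v) K~v
    where
    K⊆Nbhd : K ⊆ Nbhd v
    K⊆Nbhd x∈K = p∩q⊆q W (Nbhd v) (K⊆W∩N x∈K)
    v∉K : v ∉ K
    v∉K v∈K = v∉Nbhd[v] v (K⊆Nbhd v∈K)
    K∪v⊆W : K ∪ ⁅ v ⁆ ⊆ W
    K∪v⊆W x∈ with x∈p∪q⁻ K ⁅ v ⁆ x∈
    ... | inj₁ x∈K = p∩q⊆p W (Nbhd v) (K⊆W∩N x∈K)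
    ... | inj₂ x∈v = subst (_∈ W) (sym (x∈⁅y⁆⇒x≡y v x∈v)) v∈W
    K~v : ∀ {x y} → x ∈ K → y ∈ ⁅ v ⁆ → adj G x y ≡ true
    K~v x∈K y∈v rewrite x∈⁅y⁆⇒x≡y v y∈v = trans (Graph.sym G _ v) (∈-tabulate⁻ (K⊆Nbhd x∈K))

  cliqueFree⇒∣W∣≤j*t : ∀ {U W t} j → CliqueFree (suc j) U → W ⊆ U →
                        (∀ {v} → v ∈ W → ∣ nonNbhdIn U v ∣ < t) → ∣ W ∣ ≤ j * t
  cliqueFree⇒∣W∣≤j*t j U-free W⊆U few = ≮⇒≥ λ j*t<∣W∣ →
    let K , K⊆W , ∣K∣≡1+j , K-clique = greedy-clique j W⊆U few j*t<∣W∣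
    in U-free (⊆-trans K⊆W W⊆U) ∣K∣≡1+j K-clique

  manyNonNbhdIn : Subset n → ℕ → Subset n
  manyNonNbhdIn U t = tabulate (λ v → ⌊ t ≤? ∣ nonNbhdIn U v ∣ ⌋)

  ∣U∣≤∣U∩manyNonNbhdIn∣+j*t : ∀ {U} j t → CliqueFree (suc j) U → ∣ U ∣ ≤ ∣ U ∩ manyNonNbhdIn U t ∣ + j * t
  ∣U∣≤∣U∩manyNonNbhdIn∣+j*t {U} j t U-free = begin
    ∣ U ∣                ≤⟨ p⊆q⇒∣p∣≤∣q∣ U⊆L∪W ⟩
    ∣ L ∪ W ∣            ≤⟨ ∣p∪q∣≤∣p∣+∣q∣ L W ⟩
    ∣ L ∣ + ∣ W ∣        ≤⟨ +-monoʳ-≤ ∣ L ∣ (cliqueFree⇒∣W∣≤j*t j U-free (p─q⊆p U many) few) ⟩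
    ∣ L ∣ + j * t        ∎
    where
    open ≤-Reasoning
    many = manyNonNbhdIn U t
    L = U ∩ many
    W = U ─ many
    U⊆L∪W : U ⊆ L ∪ W
    U⊆L∪W {v} v∈U with v ∈? many
    ... | yes v∈many = x∈p∪q⁺ (inj₁ (x∈p∩q⁺ (v∈U , v∈many)))
    ... | no  v∉many = x∈p∪q⁺ (inj₂ (x∈p∧x∉q⇒x∈p─q v∈U v∉many))
    few : ∀ {v} → v ∈ W → ∣ nonNbhdIn U v ∣ < t
    few {v} v∈W = ≰⇒> λ t≤ →
      x∈p─q⇒x∉q U many v∈W (∈-tabulate⁺ (⌊⌋≡true⁺ (t ≤? ∣ nonNbhdIn U v ∣) t≤))

  numIndepIn-nonNbhdIn≤ : ∀ {U v} s → v ∈ U →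
    numIndepIn (nonNbhdIn U v) s ≤ countSubsets (λ S → isIndepSetIn U (suc s) S ∧ lookup S v)
  numIndepIn-nonNbhdIn≤ {U} {v} s v∈U =
    countSubsets-≤-injection {p = isIndepSetIn (nonNbhdIn U v) s}
      {q = λ S → isIndepSetIn U (suc s) S ∧ lookup S v}
      (_∪ ⁅ v ⁆) (λ {S} {S′} hS hS′ → ∪⁅x⁆-injective (v∉ S hS) (v∉ S′ hS′)) (λ {S} → extend S)
    where
    v∉ : ∀ S → isIndepSetIn (nonNbhdIn U v) s S ≡ true → v ∉ S
    v∉ S h v∈S = v∉nonNbhdIn U v (proj₁ (isIndepSetIn-sound _ s S h) v∈S)
    extend : ∀ S → isIndepSetIn (nonNbhdIn U v) s S ≡ true →
             (isIndepSetIn U (suc s) (S ∪ ⁅ v ⁆) ∧ lookup (S ∪ ⁅ v ⁆) v) ≡ true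
    extend S h with S⊆N , S-indep , ∣S∣≡s ← isIndepSetIn-sound _ s S h
      = cong₂ _∧_ (isIndepSetIn-complete U (suc s) (S ∪ ⁅ v ⁆) (S∪v⊆U , S∪v-indep , ∣S∪v∣≡1+s))
                  ([]=⇒lookup (x∈p∪q⁺ {p = S} (inj₂ (x∈⁅x⁆ v))))
      where
      S∪v⊆U : S ∪ ⁅ v ⁆ ⊆ U
      S∪v⊆U x∈ with x∈p∪q⁻ S ⁅ v ⁆ x∈
      ... | inj₁ x∈S = nonNbhdIn⊆ U v (S⊆N x∈S)
      ... | inj₂ x∈v = subst (_∈ U) (sym (x∈⁅y⁆⇒x≡y v x∈v)) v∈U
      S∪v-indep : IsIndependent (S ∪ ⁅ v ⁆)
      S∪v-indep = independent-∪ S-indep (⁅⁆-independent v) λ x∈S y∈v →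
        subst (λ y → adj G _ y ≡ false) (sym (x∈⁅y⁆⇒x≡y v y∈v))
              (trans (Graph.sym G _ v) (∈nonNbhdIn⇒≁ (S⊆N x∈S)))
      ∣S∪v∣≡1+s : ∣ S ∪ ⁅ v ⁆ ∣ ≡ suc s
      ∣S∪v∣≡1+s = trans (x∉p⇒∣p∪⁅x⁆∣≡1+∣p∣ S (v∉ S h)) (cong suc ∣S∣≡s)

  -- Double counting the pairs (v, S) with v ∈ S and S an independent (s+1)-set in U.
  sumOver-numIndepIn-nonNbhdIn≤ : ∀ U s →
    sumOver U (λ v → numIndepIn (nonNbhdIn U v) s) ≤ suc s * numIndepIn U (suc s)
  sumOver-numIndepIn-nonNbhdIn≤ U s = begin
    sumOver U (λ v → numIndepIn (nonNbhdIn U v) s)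
      ≤⟨ sum-mono-≤ pointwise ⟩
    ∑[ v < n ] countSubsets (λ S → isIndepSetIn U (suc s) S ∧ lookup S v)
      ≡⟨ ∑-countSubsets-∋ (isIndepSetIn U (suc s)) (λ {S} h → proj₂ (proj₂ (isIndepSetIn-sound U (suc s) S h))) ⟩
    suc s * numIndepIn U (suc s)
      ∎
    where
    open ≤-Reasoning
    pointwise : ∀ v → indicator (lookup U v) * numIndepIn (nonNbhdIn U v) s ≤
                      countSubsets (λ S → isIndepSetIn U (suc s) S ∧ lookup S v)
    pointwise v with lookup U v in v∈U
    ... | false = z≤n
    ... | true rewrite +-identityʳ (numIndepIn (nonNbhdIn U v) s) =
      numIndepIn-nonNbhdIn≤ s (lookup⇒[]= v U v∈U)

  numIndepIn-lower-bound : ∀ j s k {U} → CliqueFree (suc j) U → suc j ^ s * k ≤ ∣ U ∣ →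
                           k ^ s * suc j ^ triangular s ≤ s ! * numIndepIn U s
  numIndepIn-lower-bound j zero k {U} _ _ = ≤-trans
    (countSubsets-pos {p = isIndepSetIn U 0} ∅
      (isIndepSetIn-complete U 0 ∅ (⊥⊆ , (λ x∈∅ → contradiction x∈∅ ∉⊥) , ∣⊥∣≡0 n)))
    (≤-reflexive (sym (+-identityʳ _)))
  numIndepIn-lower-bound j (suc s) k {U} U-free a^[1+s]*k≤∣U∣ = begin
    k ^ suc s * a ^ triangular (suc s)                    ≡⟨ regroup ⟩
    t * c                                                 ≤⟨ *-monoˡ-≤ c t≤∣L∣ ⟩
    ∣ L ∣ * c                                             ≤⟨ ∣L∣*c≤d*sumOver {d = s !} (p∩q⊆p U many) c≤ ⟩
    s ! * sumOver U (λ v → numIndepIn (nonNbhdIn U v) s)  ≤⟨ *-monoʳ-≤ (s !) (sumOver-numIndepIn-nonNbhdIn≤ U s) ⟩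
    s ! * (suc s * numIndepIn U (suc s))                  ≡⟨ reorder (s !) (suc s) (numIndepIn U (suc s)) ⟩
    suc s ! * numIndepIn U (suc s)                        ∎
    where
    open ≤-Reasoning
    a = suc j
    t = a ^ s * k
    c = k ^ s * a ^ triangular s
    many = manyNonNbhdIn U t
    L = U ∩ many
    t≤∣L∣ : t ≤ ∣ L ∣
    t≤∣L∣ = +-cancelʳ-≤ (j * t) t ∣ L ∣
      (≤-trans (≤-trans (≤-reflexive (sym (*-assoc a (a ^ s) k))) a^[1+s]*k≤∣U∣)
               (∣U∣≤∣U∩manyNonNbhdIn∣+j*t j t U-free))
    c≤ : ∀ {v} → v ∈ L → c ≤ s ! * numIndepIn (nonNbhdIn U v) s
    c≤ {v} v∈L = numIndepIn-lower-bound j s k (cliqueFree-⊆ (nonNbhdIn⊆ U v) U-free)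
      (⌊⌋≡true⁻ (t ≤? ∣ nonNbhdIn U v ∣) (∈-tabulate⁻ (p∩q⊆q U many v∈L)))
    regroup : k ^ suc s * a ^ triangular (suc s) ≡ t * c
    regroup = trans (cong (k ^ suc s *_) (^-distribˡ-+-* a s (triangular s)))
                    (shuffle k (k ^ s) (a ^ s) (a ^ triangular s))
      where
      shuffle : ∀ k K A T → k * K * (A * T) ≡ A * k * (K * T)
      shuffle = solve-∀
    reorder : ∀ f m N → f * (m * N) ≡ m * f * N
    reorder = solve-∀

-- Ramsey's property applied inside a vertex set

indepSet-from-Ramsey : ∀ {n a b} (G : Graph n) (S : Subset n) → RamseyProp a b ∣ S ∣ →
                       CliqueFree G a S → ∃[ I ] IndepSetIn G S b I
indepSet-from-Ramsey G S ramsey S-free with ramsey (induced G S)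
... | inj₁ (K , ∣K∣≡a , K-clique) =
  ⊥-elim (S-free (embedSubset⊆ S K) (trans (∣embedSubset∣ S K) ∣K∣≡a) embedded-clique)
  where
  embedded-clique : IsClique G (embedSubset S K)
  embedded-clique x∈ y∈ x≢y with ∈embedSubset⁻ S K x∈ | ∈embedSubset⁻ S K y∈
  ... | i , i∈K , refl | j , j∈K , refl =
    isClique-sound (induced G S) K-clique i∈K j∈K (λ i≡j → x≢y (cong (embed S) i≡j))
... | inj₂ (I , ∣I∣≡b , I-indep) =
  embedSubset S I , embedSubset⊆ S I , embedded-indep , trans (∣embedSubset∣ S I) ∣I∣≡b
  where
  embedded-indep : IsIndependent G (embedSubset S I)
  embedded-indep x∈ y∈ with ∈embedSubset⁻ S I x∈ | ∈embedSubset⁻ S I y∈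
  ... | i , i∈I , refl | j , j∈I , refl = isIndep-sound (induced G S) I-indep i∈I j∈I

numIndepIn-pos : ∀ {n a s R} (G : Graph n) {U} → CliqueFree G a U → RamseyProp a s R → R ≤ ∣ U ∣ →
                 1 ≤ numIndepIn G U s
numIndepIn-pos {s = s} G {U} U-free ramsey R≤∣U∣ =
  let S , S⊆U , ∣S∣≡R = ∃⊆-with-size _ U R≤∣U∣
      I , I⊆S , I-indep , ∣I∣≡s = indepSet-from-Ramsey G S (subst (RamseyProp _ _) (sym ∣S∣≡R) ramsey)
                                     (cliqueFree-⊆ G S⊆U U-free)
  in countSubsets-pos I (isIndepSetIn-complete G U s I (⊆-trans I⊆S S⊆U , I-indep , ∣I∣≡s))

numIndepIn-bound : ∀ {n j s b R} (G : Graph n) {U} → CliqueFree G (suc j) U → RamseyProp (suc j) s R →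
                   R ≤ ∣ U ∣ → suc j ≤ b → s ≤ b → ∣ U ∣ ^ s ≤ numIndepIn G U s * (2 * b ^ s) ^ s
numIndepIn-bound {j = j} {s} G {U} U-free ramsey R≤∣U∣ a≤b s≤b with suc j ^ s ≤? ∣ U ∣
... | no  a^s≰∣U∣ = d^s≤-when-d<a^s {s = s} a≤b (≰⇒> a^s≰∣U∣) (numIndepIn-pos G U-free ramsey R≤∣U∣)
... | yes a^s≤∣U∣ =
  let k , a^s*k≤∣U∣ , ∣U∣≤2*a^s*k = ∃k[q*k≤d≤2*q*k] (suc j ^ s) ∣ U ∣ {{m^n≢0 (suc j) s}} a^s≤∣U∣
  in d^s≤-when-a^s≤d {s = s} a≤b s≤b ∣U∣≤2*a^s*k (numIndepIn-lower-bound G j s k U-free a^s*k≤∣U∣)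

lemma3 : (r s t m : ℕ) → 1 ≤ r → 1 ≤ s → 1 ≤ t → 1 ≤ m →
    {n : ℕ} → (G : Graph n) →
    ¬ HasClique G r → ¬ HasInducedKst G s t →
    (X : Subset n) → ∣ X ∣ ≡ m ∸ 1 → isClique G X ≡ true →
    (∃[ R ] (IsRamseyNumber (r ∸ m + 1) s R × R < deg G X)) →
    deg G X ^ s ≤ numIndepInNbhd G X s * (2 * (r + s) ^ s) ^ s
lemma3 r s t (suc m) _ 1≤s _ (s≤s z≤n) G no-Kr _ X ∣X∣≡m X-clique (R , (ramsey , _) , R<d) =
  numIndepIn-bound G N-free (subst (λ a → RamseyProp a s R) (+-comm (r ∸ suc m) 1) ramsey) (<⇒≤ R<d)
    a≤r+s (m≤n+m s r)
  where
  open ≤-Reasoning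
  N-free : CliqueFree G (suc (r ∸ suc m)) (commonNbhd G X)
  N-free = cliqueFree-commonNbhd G no-Kr (isClique-sound G {X} X-clique) (begin
    r                        ≤⟨ m≤n+m∸n r (suc m) ⟩
    suc m + (r ∸ suc m)      ≡⟨ +-suc m (r ∸ suc m) ⟨
    m + suc (r ∸ suc m)      ≡⟨ cong (_+ suc (r ∸ suc m)) ∣X∣≡m ⟨
    ∣ X ∣ + suc (r ∸ suc m)  ∎)
  a≤r+s : suc (r ∸ suc m) ≤ r + s
  a≤r+s = begin
    suc (r ∸ suc m)  ≡⟨ +-comm 1 (r ∸ suc m) ⟩
    r ∸ suc m + 1    ≤⟨ +-mono-≤ (m∸n≤m r (suc m)) 1≤s ⟩
    r + s            ∎
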